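{- Let $G$ be a snark and $F$ a $2$-factor of $G$. Let $F_{\mathrm{odd}}$ (resp. $F_{\mathrm{even}}$) be the subgraph of $F$ formed by all odd (resp. even) length cycles of $F$. If there exists a perfect matching $M_{\mathrm{even}}$ of $F_{\mathrm{even}}$ such that the corresponding odd-cycle-incidence graph $K_{\mathrm{odd}}$ has a perfect matching, then there exists a maximum matching $M$ in $F$ such that $H=G-M$ has a simple $F$-matching.
   Context: A snark is a bridgeless cubic graph that is not 3-edge-colorable. A $2$-factor is a spanning $2$-regular subgraph. For a perfect matching $M_{\mathrm{even}}$ of $F_{\mathrm{even}}$, let $H_{\mathrm{odd}}=G-M_{\mathrm{even}}$ (the spanning subgraph with edge set $E(G)\setminus M_{\mathrm{even}}$); the odd-cycle-incidence graph $K_{\mathrm{odd}}$ is the graph obtained from $H_{\mathrm{odd}}$ by contracting all edges of $F_{\mathrm{odd}}$ (so each odd cycle of $F$ becomes one vertex) and suppressing all vertices of degree $2$. For a matching $M\subseteq E(F)$, $H=G-M$ is the spanning subgraph with edge set $E(G)\setminus M$; its vertices have degree $2$ or $3$ ($2$-vertices, $3$-vertices). An end-edge of a path is an edge incident to one of its end-vertices. An $F$-path in $H$ is a path in $H$ whose end-vertices are $3$-vertices of $H$, whose interior vertices are $2$-vertices of $H$, and whose end-edges belong to $E(F)$. An $F$-matching of $H$ is a collection of pairwise vertex-disjoint $F$-paths such that every $3$-vertex of $H$ is an end-vertex of exactly one path of the collection. An $F$-matching is simple if for each of its $F$-paths, the only edges of the path that belong to odd length cycles of $F$ are the edges incident to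 its end-vertices. -}

module Defs where

open import Data.Nat using (ℕ; zero; suc; _+_; _≤_; _%_)
open import Data.Bool using (Bool; true; false; T; _∧_; _∨_; not; if_then_else_)
open import Data.Fin using (Fin; zero; suc; inject₁; fromℕ; _≟_)
open import Data.Product using (Σ; ∃; ∃-syntax; _×_; _,_; proj₁; proj₂)
open import Data.Sum using (_⊎_)
open import Data.List using (List; length)
open import Data.List.Membership.Propositional using (_∈_)
open import Data.List.Relation.Unary.Unique.Propositional using (Unique)
open import Relation.Nullary using (¬_)
open import Relation.Nullary.Decidable using (⌊_⌋)
open import Relation.Binary.PropositionalEquality using (_≡_; _≢_)

record Graph : Set where
  field
    n        : ℕ
    m        : ℕ
    ends     : Fin m → Fin n × Fin n
    loopless : ∀ e → proj₁ (ends e) ≢ proj₂ (ends e)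

count : ∀ {k} → (Fin k → Bool) → ℕ
count {zero}  f = 0
count {suc k} f = (if f zero then 1 else 0) + count (λ i → f (suc i))

module _ (G : Graph) where
  open Graph G

  -- a set of edges of G (spanning subgraph of G with that edge set)
  EdgeSet : Set
  EdgeSet = Fin m → Bool

  allEdges : EdgeSet
  allEdges _ = true

  -- S ∖ M : the spanning subgraph with edge set S minus M (G - M = allEdges ∖ M)
  _∖_ : EdgeSet → EdgeSet → EdgeSet
  (S ∖ M) e = S e ∧ not (M e)

  incident : Fin m → Fin n → Bool
  incident e v = ⌊ proj₁ (ends e) ≟ v ⌋ ∨ ⌊ proj₂ (ends e) ≟ v ⌋

  deg : EdgeSet → Fin n → ℕ
  deg S v = count (λ e → S e ∧ incident e v)

  Joins : Fin m → Fin n → Fin n → Set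
  Joins e u w = (ends e ≡ (u , w)) ⊎ (ends e ≡ (w , u))

  data Walk (S : EdgeSet) : Fin n → Fin n → Set where
    nil  : ∀ {u} → Walk S u u
    cons : ∀ {u w v} (e : Fin m) → T (S e) → Joins e u w → Walk S w v → Walk S u v

  Cubic : Set
  Cubic = ∀ v → deg allEdges v ≡ 3

  Bridgeless : Set
  Bridgeless = ∀ e → Walk (λ f → not ⌊ f ≟ e ⌋) (proj₁ (ends e)) (proj₂ (ends e))

  ThreeEdgeColourable : Set
  ThreeEdgeColourable =
    Σ (Fin m → Fin 3) λ c → ∀ e f → e ≢ f →
      (∃[ v ] (T (incident e v) × T (incident f v))) → c e ≢ c f

  Snark : Set
  Snark = Cubic × Bridgeless × ¬ ThreeEdgeColourable

  IsTwoFactor : EdgeSet → Set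
  IsTwoFactor F = ∀ v → deg F v ≡ 2

  -- the cycle of F through v (its connected component in F) has length k
  -- (number of vertices = number of edges of the cycle)
  CycleLength : EdgeSet → Fin n → ℕ → Set
  CycleLength F v k =
    Σ (List (Fin n)) λ l → Unique l × (∀ u → u ∈ l → Walk F v u)
                         × (∀ u → Walk F v u → u ∈ l) × (length l ≡ k)

  OnOddCycle : EdgeSet → Fin n → Set
  OnOddCycle F v = ∃[ k ] (CycleLength F v k × (k % 2 ≡ 1))

  OnEvenCycle : EdgeSet → Fin n → Set
  OnEvenCycle F v = ∃[ k ] (CycleLength F v k × (k % 2 ≡ 0))

  IsPerfectMatchingOfFeven : EdgeSet → EdgeSet → Set
  IsPerfectMatchingOfFeven F M =
    (∀ e → T (M e) → T (F e) × OnEvenCycle F (proj₁ (ends e)) × OnEvenCycle F (proj₂ (ends e)))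
    × (∀ v → OnEvenCycle F v → deg M v ≡ 1)

  -- a path of length 1 + k in the spanning subgraph with edge set S
  record Path (S : EdgeSet) : Set where
    field
      k      : ℕ
      vs     : Fin (2 + k) → Fin n
      es     : Fin (1 + k) → Fin m
      inS    : ∀ i → T (S (es i))
      joins  : ∀ i → Joins (es i) (vs (inject₁ i)) (vs (suc i))
      injVs  : ∀ i j → vs i ≡ vs j → i ≡ j

    endpoint : Bool → Fin n
    endpoint false = vs zero
    endpoint true  = vs (fromℕ (suc k))

    Interior : Fin (2 + k) → Set
    Interior i = (i ≢ zero) × (i ≢ fromℕ (suc k))

    firstEdge lastEdge : Fin (1 + k)
    firstEdge = zero
    lastEdge  = fromℕ k

  open Path public

  -- Edges of K_odd (built from H_odd = G - Meven by contracting the edges of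
  -- F_odd and suppressing 2-vertices) that are not loops: these are exactly the
  -- paths of H_odd joining vertices of two different odd cycles of F whose
  -- interior vertices are the (degree-2) vertices on even cycles of F.
  IsKoddEdge : (F Meven : EdgeSet) → Path (allEdges ∖ Meven) → Set
  IsKoddEdge F Meven P =
    (∀ s → OnOddCycle F (endpoint P s))
    × (∀ i → Interior P i → OnEvenCycle F (vs P i))
    × ¬ Walk F (endpoint P false) (endpoint P true)

  -- K_odd has a perfect matching: a family of (non-loop) edges of K_odd such
  -- that every odd cycle of F (vertex of K_odd) is an end of exactly one of them.
  KoddHasPerfectMatching : (F Meven : EdgeSet) → Set
  KoddHasPerfectMatching F Meven =
    Σ ℕ λ p → Σ (Fin p → Path (allEdges ∖ Meven)) λ P →
      (∀ i → IsKoddEdge F Meven (P i))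
      × (∀ v → OnOddCycle F v → ∃[ i ] ∃[ s ] Walk F v (endpoint (P i) s))
      × (∀ i j s t → Walk F (endpoint (P i) s) (endpoint (P j) t) → (i ≡ j) × (s ≡ t))

  IsMatchingIn : EdgeSet → EdgeSet → Set
  IsMatchingIn F M = (∀ e → T (M e) → T (F e)) × (∀ v → deg M v ≤ 1)

  IsMaximumMatchingIn : EdgeSet → EdgeSet → Set
  IsMaximumMatchingIn F M =
    IsMatchingIn F M × (∀ M' → IsMatchingIn F M' → count M' ≤ count M)

  IsFPath : (F M : EdgeSet) → Path (allEdges ∖ M) → Set
  IsFPath F M P =
    (∀ s → deg (allEdges ∖ M) (endpoint P s) ≡ 3)
    × (∀ i → Interior P i → deg (allEdges ∖ M) (vs P i) ≡ 2)
    × T (F (es P (firstEdge P))) × T (F (es P (lastEdge P)))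

  IsSimpleFPath : (F M : EdgeSet) → Path (allEdges ∖ M) → Set
  IsSimpleFPath F M P =
    ∀ j → T (F (es P j)) → OnOddCycle F (proj₁ (ends (es P j))) →
      (j ≡ firstEdge P) ⊎ (j ≡ lastEdge P)

  HasSimpleFMatching : (F M : EdgeSet) → Set
  HasSimpleFMatching F M =
    Σ ℕ λ p → Σ (Fin p → Path (allEdges ∖ M)) λ P →
      (∀ i → IsFPath F M (P i) × IsSimpleFPath F M (P i))
      × (∀ i j a b → vs (P i) a ≡ vs (P j) b → i ≡ j)
      × (∀ v → deg (allEdges ∖ M) v ≡ 3 → ∃[ i ] ∃[ s ] (endpoint (P i) s ≡ v))

-- Each odd cycle of F contains exactly one end y of an edge of the perfect matching of
-- K_odd; let x be an F-neighbour of y. Take M to be M_even together with, on every odd cycle C,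
-- the perfect matching of C - x formed by every second edge of C. No matching of F covers an
-- odd cycle, and M misses exactly one vertex on each, so a degree count shows M is maximum.
-- In H = G - M the 3-vertices are exactly the x's and all other vertices have degree 2.
-- Extending each K_odd edge y ... y' by the F-edges xy and y'x' gives an F-path whose edges on
-- odd cycles are only these two; the paths are disjoint since the interior vertices of the
-- K_odd edges lie on even cycles and have degree 2 in G - M_even.

module Submission where

open import Defs
open import Data.Bool using (Bool; true; false; T; _∧_; _∨_; not; if_then_else_)
open import Data.Bool.Properties using (T-∧; T-∨; T-≡; T-not-≡; ∧-comm; ∧-identityʳ; not-involutive)
open import Data.Empty using (⊥; ⊥-elim)
open import Data.Fin using (Fin; zero; suc; _≟_; toℕ; fromℕ; fromℕ<; inject₁)
open import Data.Fin.Properties using (any?; pigeonhole; toℕ<n; toℕ-fromℕ<; toℕ-fromℕ; toℕ-inject₁; toℕ-injective)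
open import Data.Fin.Relation.Unary.Top using (view; ‵fromℕ; ‵inj₁; view-fromℕ; view-inject₁)
open import Data.List using (List; []; _∷_; _++_; length; filter; tabulate; allFin)
open import Data.List.Properties using (length-++; length-tabulate)
open import Data.List.Membership.Propositional using (_∈_)
open import Data.List.Membership.Propositional.Properties
  using (∈-filter⁺; ∈-filter⁻; ∈-allFin; ∈-tabulate⁺; ∈-tabulate⁻; ∈-++⁺ˡ; ∈-++⁺ʳ; ∈-++⁻)
open import Data.List.Relation.Binary.Disjoint.Propositional using (Disjoint)
open import Data.List.Relation.Binary.Subset.Propositional using (_⊆_)
open import Data.List.Relation.Unary.All using (All; []; _∷_)
open import Data.List.Relation.Unary.AllPairs using ([]; _∷_)
open import Data.List.Relation.Unary.Any using (here; there)
open import Data.List.Relation.Unary.Unique.Propositional using (Unique)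
open import Data.List.Relation.Unary.Unique.Propositional.Properties using (filter⁺; allFin⁺; tabulate⁺; ++⁺)
open import Data.Nat using (ℕ; zero; suc; _+_; _∸_; _≤_; _<_; _≤?_; _≡ᵇ_; _%_; z≤n; s≤s; parity)
import Data.Nat as ℕ
open import Data.Nat.DivMod using (m%n<n)
open import Data.Nat.Properties
  using ( ≤-refl; ≤-reflexive; ≤-trans; ≤-antisym; ≤-pred; <-trans; <-≤-trans; <-cmp; <⇒≢; <⇒≱; ≰⇒>
        ; n<1+n; n≤1+n; 1+n≢n; m≤n⇒m<n∨m≡n; n≤1⇒n≡0∨n≡1; suc-injective; +-suc; +-identityʳ; m+[n∸m]≡n
        ; +-mono-<; +-monoʳ-≤; +-cancelʳ-≤; ≡ᵇ⇒≡; ≡⇒≡ᵇ; +-0-commutativeMonoid; module ≤-Reasoning)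
open import Algebra.Properties.CommutativeMonoid.Sum +-0-commutativeMonoid using (sum; sum-cong-≗; ∑-distrib-+; ∑-comm)
open import Data.Parity using (Parity; 0ℙ; 1ℙ; _⁻¹)
import Data.Parity.Properties as Parity
open import Data.Product using (Σ; ∃; ∃-syntax; _×_; _,_; proj₁; proj₂)
open import Data.Sum using (_⊎_; inj₁; inj₂; [_,_]′)
import Data.Sum as Sum
open import Data.Unit using (tt)
open import Function using (_∘_; _⇔_; mk⇔; Equivalence)
open Equivalence using (to; from)
import Function.Properties.Equivalence as ⇔
open import Relation.Binary.Definitions using (DecidableEquality; tri<; tri≈; tri>)
open import Relation.Binary.PropositionalEquality
  using (_≡_; _≢_; refl; sym; trans; cong; cong₂; subst; subst₂; module ≡-Reasoning)
open import Relation.Nullary using (¬_; Dec; yes; no)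
open import Relation.Nullary.Decidable using (T?; ⌊_⌋; toWitness; fromWitness; _×-dec_; _⊎-dec_)
import Relation.Nullary.Decidable as Dec

-- Counting

module _ {A : Set} (_≟_ : DecidableEquality A) where

  private
    removeFirst : A → List A → List A
    removeFirst x [] = []
    removeFirst x (y ∷ ys) with x ≟ y
    ... | yes _ = ys
    ... | no _  = y ∷ removeFirst x ys

    length-removeFirst : ∀ {x ys} → x ∈ ys → suc (length (removeFirst x ys)) ≡ length ys
    length-removeFirst {x} {y ∷ ys} x∈ with x ≟ y
    ... | yes _ = refl
    length-removeFirst (here x≡y) | no x≢y = ⊥-elim (x≢y x≡y)
    length-removeFirst (there x∈) | no _   = cong suc (length-removeFirst x∈)

    ∈-removeFirst : ∀ {x z ys} → z ∈ ys → z ≢ x → z ∈ removeFirst x ys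
    ∈-removeFirst {x} {ys = y ∷ ys} z∈ z≢x with x ≟ y
    ∈-removeFirst (here refl) z≢x | yes refl = ⊥-elim (z≢x refl)
    ∈-removeFirst (there z∈)  z≢x | yes _    = z∈
    ∈-removeFirst (here z≡y)  z≢x | no _     = here z≡y
    ∈-removeFirst (there z∈)  z≢x | no _     = there (∈-removeFirst z∈ z≢x)

    ∉-All : ∀ {x : A} {xs z} → All (x ≢_) xs → z ∈ xs → z ≢ x
    ∉-All (x≢z ∷ _) (here refl) z≡x = x≢z (sym z≡x)
    ∉-All (_ ∷ ne) (there z∈) = ∉-All ne z∈

  length-mono-⊆ : ∀ {xs ys : List A} → Unique xs → xs ⊆ ys → length xs ≤ length ys
  length-mono-⊆ {[]} _ _ = z≤n
  length-mono-⊆ {x ∷ xs} {ys} (x∉xs ∷ u) xs⊆ys =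
    subst (suc (length xs) ≤_) (length-removeFirst (xs⊆ys (here refl)))
      (s≤s (length-mono-⊆ u λ z∈ → ∈-removeFirst (xs⊆ys (there z∈)) (∉-All x∉xs z∈)))

  length-cong-⊆⊇ : ∀ {xs ys : List A} → Unique xs → Unique ys → xs ⊆ ys → ys ⊆ xs → length xs ≡ length ys
  length-cong-⊆⊇ uxs uys xs⊆ys ys⊆xs = ≤-antisym (length-mono-⊆ uxs xs⊆ys) (length-mono-⊆ uys ys⊆xs)

¬T⇒T-not : ∀ {b} → ¬ T b → T (not b)
¬T⇒T-not {false} _  = tt
¬T⇒T-not {true}  ¬b = ¬b tt

bit : Bool → ℕ
bit b = if b then 1 else 0

count-tabulate : ∀ {B : Set} {k} (f : B → Bool) (g : Fin k → B) →
  count (f ∘ g) ≡ length (filter (T? ∘ f) (tabulate g))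
count-tabulate {k = zero} f g = refl
count-tabulate {k = suc k} f g with f (g zero)
... | true  = cong suc (count-tabulate f (g ∘ suc))
... | false = count-tabulate f (g ∘ suc)

module _ {k : ℕ} {f : Fin k → Bool} where

  private
    trues : List (Fin k)
    trues = filter (T? ∘ f) (allFin k)

    ∈-trues⁺ : ∀ {i} → T (f i) → i ∈ trues
    ∈-trues⁺ {i} = ∈-filter⁺ (T? ∘ f) (∈-allFin i)

    ∈-trues⁻ : ∀ {i} → i ∈ trues → T (f i)
    ∈-trues⁻ = proj₂ ∘ ∈-filter⁻ (T? ∘ f) {xs = allFin k}

    count≡length-trues : count f ≡ length trues
    count≡length-trues = count-tabulate f (λ i → i)

  count≡length : ∀ {xs} → Unique xs → (∀ {i} → i ∈ xs → T (f i)) → (∀ {i} → T (f i) → i ∈ xs) →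
    count f ≡ length xs
  count≡length uxs xs⊆f f⊆xs = trans count≡length-trues
    (length-cong-⊆⊇ _≟_ (filter⁺ (T? ∘ f) (allFin⁺ k)) uxs (f⊆xs ∘ ∈-trues⁻) (∈-trues⁺ ∘ xs⊆f))

  length≤count : ∀ {xs} → Unique xs → (∀ {i} → i ∈ xs → T (f i)) → length xs ≤ count f
  length≤count {xs} uxs xs⊆f =
    subst (length xs ≤_) (sym count≡length-trues) (length-mono-⊆ _≟_ uxs (∈-trues⁺ ∘ xs⊆f))

  count≡0 : (∀ i → ¬ T (f i)) → count f ≡ 0
  count≡0 ¬f = count≡length [] (λ ()) (λ {i} fi → ⊥-elim (¬f i fi))

  count≡0⇒ : count f ≡ 0 → ∀ i → ¬ T (f i)
  count≡0⇒ c≡0 i fi with subst (1 ≤_) c≡0 (length≤count ([] ∷ []) (λ { (here refl) → fi }))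
  ... | ()

  count≡2-only : count f ≡ 2 → ∀ {a b c} → a ≢ b → T (f a) → T (f b) → T (f c) → c ≡ a ⊎ c ≡ b
  count≡2-only c≡2 {a} {b} {c} a≢b fa fb fc with c ≟ a | c ≟ b
  ... | yes c≡a | _ = inj₁ c≡a
  ... | no _ | yes c≡b = inj₂ c≡b
  ... | no c≢a | no c≢b
    with subst (3 ≤_) c≡2 (length≤count ((a≢b ∷ (c≢a ∘ sym) ∷ []) ∷ ((c≢b ∘ sym) ∷ []) ∷ [] ∷ [])
                                         λ { (here refl) → fa ; (there (here refl)) → fb ; (there (there (here refl))) → fc })
  ... | s≤s (s≤s ())

  count≡2⇒ : count f ≡ 2 → Σ (Fin k) λ a → Σ (Fin k) λ b → a ≢ b × T (f a) × T (f b)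
  count≡2⇒ c≡2 with trues | filter⁺ (T? ∘ f) (allFin⁺ k) | ∈-trues⁻ | count≡length-trues
  ... | a ∷ b ∷ [] | (a≢b ∷ []) ∷ _ | ∈⇒f | _ = a , b , a≢b , ∈⇒f (here refl) , ∈⇒f (there (here refl))
  ... | []             | _ | _ | c≡0 with () ← trans (sym c≡2) c≡0
  ... | _ ∷ []         | _ | _ | c≡1 with () ← trans (sym c≡2) c≡1
  ... | _ ∷ _ ∷ _ ∷ _  | _ | _ | c≡3 with () ← trans (sym c≡2) c≡3

  count-pair : ∀ {a b} → a ≢ b → (∀ {i} → T (f i) → i ≡ a ⊎ i ≡ b) → count f ≡ bit (f a) + bit (f b)
  count-pair {a} {b} a≢b only with f a in fa | f b in fb
  ... | true | true = count≡length ((a≢b ∷ []) ∷ [] ∷ [])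
          (λ { (here refl) → from T-≡ fa ; (there (here refl)) → from T-≡ fb })
          (λ fi → [ here , there ∘ here ]′ (only fi))
  ... | true | false = count≡length ([] ∷ [])
          (λ { (here refl) → from T-≡ fa })
          (λ fi → [ here , (λ { refl → ⊥-elim (subst T fb fi) }) ]′ (only fi))
  ... | false | true = count≡length ([] ∷ [])
          (λ { (here refl) → from T-≡ fb })
          (λ fi → [ (λ { refl → ⊥-elim (subst T fa fi) }) , here ]′ (only fi))
  ... | false | false = count≡0 λ i fi → [ (λ { refl → subst T fa fi }) , (λ { refl → subst T fb fi }) ]′ (only fi)

count-cong : ∀ {k} {f g : Fin k → Bool} → (∀ i → f i ≡ g i) → count f ≡ count g
count-cong {zero} f≗g = refl
count-cong {suc k} f≗g = cong₂ _+_ (cong bit (f≗g zero)) (count-cong (f≗g ∘ suc))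

count-∧-split : ∀ {k} (f g : Fin k → Bool) →
  count f ≡ count (λ i → f i ∧ g i) + count (λ i → f i ∧ not (g i))
count-∧-split {zero} f g = refl
count-∧-split {suc k} f g with f zero | g zero
... | true  | true  = cong suc (count-∧-split (f ∘ suc) (g ∘ suc))
... | true  | false = trans (cong suc (count-∧-split (f ∘ suc) (g ∘ suc))) (sym (+-suc _ _))
... | false | _     = count-∧-split (f ∘ suc) (g ∘ suc)

count≡sum : ∀ {k} (f : Fin k → Bool) → count f ≡ sum (bit ∘ f)
count≡sum {zero} f = refl
count≡sum {suc k} f = cong (bit (f zero) +_) (count≡sum (f ∘ suc))

minimal : {Q : ℕ → Set} → (∀ b → Dec (Q b)) → ∀ {b} → Q b → Σ ℕ λ b′ → Q b′ × (∀ {c} → c < b′ → ¬ Q c)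
minimal {Q} Q? {b} q = search (suc b) (b , ≤-refl , q)
  where
  below? : ∀ bound → Dec (Σ ℕ λ c → c < bound × Q c)
  below? bound with any? {n = bound} (Q? ∘ toℕ)
  ... | yes (i , qi) = yes (toℕ i , toℕ<n i , qi)
  ... | no none = no λ (c , c< , qc) → none (fromℕ< c< , subst Q (sym (toℕ-fromℕ< c<)) qc)
  search : ∀ bound → (Σ ℕ λ c → c < bound × Q c) → Σ ℕ λ b′ → Q b′ × (∀ {c} → c < b′ → ¬ Q c)
  search (suc bound) (c , s≤s c≤bound , qc) with below? bound
  ... | yes smaller = search bound smaller
  ... | no none = c , qc , λ c′<c qc′ → none (_ , <-≤-trans c′<c c≤bound , qc′)

sum+zeros : ∀ {k} (d : Fin k → ℕ) → (∀ i → d i ≤ 1) → sum d + count (λ i → d i ≡ᵇ 0) ≡ k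
sum+zeros {zero} d d≤1 = refl
sum+zeros {suc k} d d≤1 with d zero | d≤1 zero | sum+zeros (d ∘ suc) (d≤1 ∘ suc)
... | 0 | _       | eq = trans (+-suc _ _) (cong suc eq)
... | 1 | _       | eq = cong suc eq
... | suc (suc _) | s≤s () | _

+-double-cancel-≤ : ∀ {a b} → a + a ≤ b + b → a ≤ b
+-double-cancel-≤ {a} {b} a+a≤b+b with a ≤? b
... | yes a≤b = a≤b
... | no  a≰b = ⊥-elim (<⇒≱ (+-mono-< (≰⇒> a≰b) (≰⇒> a≰b)) a+a≤b+b)

module _ {A : Set} {p : ℕ} (f : Fin p → Bool → A) where

  bothSides : List A
  bothSides = tabulate (λ i → f i false) ++ tabulate (λ i → f i true)

  length-bothSides : length bothSides ≡ p + p
  length-bothSides = trans (length-++ (tabulate (λ i → f i false)))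
    (cong₂ _+_ (length-tabulate (λ i → f i false)) (length-tabulate (λ i → f i true)))

  ∈-bothSides⁺ : ∀ i s → f i s ∈ bothSides
  ∈-bothSides⁺ i false = ∈-++⁺ˡ (∈-tabulate⁺ i)
  ∈-bothSides⁺ i true  = ∈-++⁺ʳ _ (∈-tabulate⁺ i)

  ∈-bothSides⁻ : ∀ {a} → a ∈ bothSides → Σ (Fin p) λ i → Σ Bool λ s → a ≡ f i s
  ∈-bothSides⁻ a∈ with ∈-++⁻ (tabulate (λ i → f i false)) a∈
  ... | inj₁ a∈ = let (i , a≡) = ∈-tabulate⁻ a∈ in i , false , a≡
  ... | inj₂ a∈ = let (i , a≡) = ∈-tabulate⁻ a∈ in i , true , a≡

  bothSides⁺ : (∀ {i s j t} → f i s ≡ f j t → i ≡ j × s ≡ t) → Unique bothSides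
  bothSides⁺ f-injective = ++⁺ (tabulate⁺ (proj₁ ∘ f-injective)) (tabulate⁺ (proj₁ ∘ f-injective)) disjoint
    where
    disjoint : Disjoint (tabulate (λ i → f i false)) (tabulate (λ i → f i true))
    disjoint (a∈ , a∈′) with ∈-tabulate⁻ a∈ | ∈-tabulate⁻ a∈′
    ... | i , refl | j , a≡ with () ← proj₂ (f-injective a≡)

parity-suc : ∀ t → parity (suc t) ≡ parity t ⁻¹
parity-suc t = sym (Parity.⁻¹-selfInverse (Parity.suc-homo-⁻¹ t))

suc-odd⇒even : ∀ {k} → suc k % 2 ≡ 1 → parity k ≡ 0ℙ
suc-odd⇒even {zero} _ = refl
suc-odd⇒even {suc zero} ()
suc-odd⇒even {suc (suc k)} odd = suc-odd⇒even {k} odd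

0ℙ≢1ℙ : 0ℙ ≢ 1ℙ
0ℙ≢1ℙ ()

oddBit : Parity → ℕ
oddBit 0ℙ = 0
oddBit 1ℙ = 1

bit-⇔ : ∀ {a : Bool} {q : Parity} → (T a ⇔ q ≡ 1ℙ) → bit a ≡ oddBit q
bit-⇔ {true}  {1ℙ} _ = refl
bit-⇔ {false} {0ℙ} _ = refl
bit-⇔ {true}  {0ℙ} a⇔ with () ← to a⇔ _
bit-⇔ {false} {1ℙ} a⇔ = ⊥-elim (from a⇔ refl)

oddBit+oddBit⁻¹ : ∀ q → oddBit q + oddBit (q ⁻¹) ≡ 1
oddBit+oddBit⁻¹ 0ℙ = refl
oddBit+oddBit⁻¹ 1ℙ = refl

T-∧-true : ∀ {a b} → T b → T (a ∧ b) ⇔ T a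
T-∧-true tb = mk⇔ (proj₁ ∘ to T-∧) (λ ta → from T-∧ (ta , tb))

∨-∧-disjoint : ∀ a b c → (T b → T c → ⊥) → ((a ∨ b) ∧ c) ≡ (a ∧ c)
∨-∧-disjoint true  _     _     _ = refl
∨-∧-disjoint false false _     _ = refl
∨-∧-disjoint false true  false _ = refl
∨-∧-disjoint false true  true  ¬b∧c = ⊥-elim (¬b∧c _ _)

bit+bit≡1 : ∀ {a b} → bit a + bit b ≡ 1 → b ≡ not a
bit+bit≡1 {false} {true}  _ = refl
bit+bit≡1 {true}  {false} _ = refl

alternating-period : ∀ (b : ℕ → Bool) {L} → (∀ {t} → t < suc L → b (suc t) ≡ not (b t)) →
  parity L ≡ 0ℙ → b (suc L) ≡ not (b 0)
alternating-period b {L} flips L-even = trans (flips (n<1+n L)) (cong not (even-steps L-even ≤-refl))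
  where
  even-steps : ∀ {t} → parity t ≡ 0ℙ → t ≤ L → b t ≡ b 0
  even-steps {zero} _ _ = refl
  even-steps {suc zero} ()
  even-steps {suc (suc t)} t-even t+2≤L = begin
    b (suc (suc t))   ≡⟨ flips (s≤s t+1≤L) ⟩
    not (b (suc t))   ≡⟨ cong not (flips (s≤s t≤L)) ⟩
    not (not (b t))   ≡⟨ not-involutive (b t) ⟩
    b t               ≡⟨ even-steps t-even t≤L ⟩
    b 0               ∎
    where
    t+1≤L = ≤-trans (n≤1+n (suc t)) t+2≤L
    t≤L   = ≤-trans (n≤1+n t) t+1≤L
    open ≡-Reasoning

any-Bool? : {P : Bool → Set} → (∀ s → Dec (P s)) → Dec (Σ Bool P)
any-Bool? P? = Dec.map′ [ (false ,_) , (true ,_) ]′ (λ { (false , x) → inj₁ x ; (true , x) → inj₂ x }) (P? false ⊎-dec P? true)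

-- Incidence, walks and degrees

module _ (G : Graph) where
  open Graph G

  otherEnd : Fin m → Fin n → Fin n
  otherEnd e v with proj₁ (ends e) ≟ v
  ... | yes _ = proj₂ (ends e)
  ... | no _  = proj₁ (ends e)

  module _ {e : Fin m} where

    joins-sym : ∀ {u w} → Joins G e u w → Joins G e w u
    joins-sym = Sum.swap

    joins⇒≢ : ∀ {u w} → Joins G e u w → u ≢ w
    joins⇒≢ (inj₁ refl) u≡w = loopless e u≡w
    joins⇒≢ (inj₂ refl) u≡w = loopless e (sym u≡w)

    incident⇔ends : ∀ {v} → T (incident G e v) ⇔ (proj₁ (ends e) ≡ v ⊎ proj₂ (ends e) ≡ v)
    incident⇔ends {v} = mk⇔
      (λ i → Sum.map (toWitness {a? = proj₁ (ends e) ≟ v}) (toWitness {a? = proj₂ (ends e) ≟ v}) (to T-∨ i))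
      (λ p → from T-∨ (Sum.map (fromWitness {a? = proj₁ (ends e) ≟ v}) (fromWitness {a? = proj₂ (ends e) ≟ v}) p))

    joins⇒incidentˡ : ∀ {u w} → Joins G e u w → T (incident G e u)
    joins⇒incidentˡ (inj₁ refl) = from incident⇔ends (inj₁ refl)
    joins⇒incidentˡ (inj₂ refl) = from incident⇔ends (inj₂ refl)

    joins⇒incidentʳ : ∀ {u w} → Joins G e u w → T (incident G e w)
    joins⇒incidentʳ = joins⇒incidentˡ ∘ joins-sym

    incident⇒joins : ∀ {v} → T (incident G e v) → Joins G e v (otherEnd e v)
    incident⇒joins {v} i with proj₁ (ends e) ≟ v | to incident⇔ends i
    ... | yes refl | _        = inj₁ refl
    ... | no ≢v    | inj₁ ≡v  = ⊥-elim (≢v ≡v)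
    ... | no _     | inj₂ refl = inj₂ refl

    joins⇒otherEnd : ∀ {u w} → Joins G e u w → otherEnd e u ≡ w
    joins⇒otherEnd {u} j with proj₁ (ends e) ≟ u | j
    ... | yes _    | inj₁ refl = refl
    ... | yes refl | inj₂ ends≡ = ⊥-elim (loopless e (cong proj₂ (sym ends≡)))
    ... | no ≢u    | inj₁ refl = ⊥-elim (≢u refl)
    ... | no _     | inj₂ refl = refl

    joins-incident : ∀ {u w z} → Joins G e u w → T (incident G e z) → z ≡ u ⊎ z ≡ w
    joins-incident (inj₁ refl) i = Sum.map sym sym (to incident⇔ends i)
    joins-incident (inj₂ refl) i = Sum.swap (Sum.map sym sym (to incident⇔ends i))

  module _ {S : EdgeSet G} where

    walk-edge : ∀ {u w} e → T (S e) → Joins G e u w → Walk G S u w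
    walk-edge e s j = cons e s j nil

    walk-++ : ∀ {u v w} → Walk G S u v → Walk G S v w → Walk G S u w
    walk-++ nil q = q
    walk-++ (cons e s j p) q = cons e s j (walk-++ p q)

    walk-reverse : ∀ {u v} → Walk G S u v → Walk G S v u
    walk-reverse nil = nil
    walk-reverse (cons e s j p) = walk-++ (walk-reverse p) (walk-edge e s (joins-sym j))

  deg-complement : ∀ M v → deg G (allEdges G) v ≡ deg G M v + deg G (_∖_ G (allEdges G) M) v
  deg-complement M v = trans (count-∧-split (λ e → incident G e v) M)
    (cong₂ _+_ (count-cong λ e → ∧-comm (incident G e v) (M e))
               (count-cong λ e → ∧-comm (incident G e v) (not (M e))))

  handshake : ∀ S → sum (deg G S) ≡ count S + count S
  handshake S = begin
    sum (λ v → deg G S v)                   ≡⟨ sum-cong-≗ (λ v → count≡sum (λ e → incidence e v)) ⟩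
    sum (λ v → sum (λ e → bit (incidence e v))) ≡⟨ ∑-comm (λ v e → bit (incidence e v)) ⟩
    sum (λ e → sum (λ v → bit (incidence e v))) ≡⟨ sum-cong-≗ (λ e → trans (sym (count≡sum (incidence e))) (endpoints e)) ⟩
    sum (λ e → bit (S e) + bit (S e))       ≡⟨ ∑-distrib-+ (bit ∘ S) (bit ∘ S) ⟩
    sum (bit ∘ S) + sum (bit ∘ S)           ≡⟨ sym (cong₂ _+_ (count≡sum S) (count≡sum S)) ⟩
    count S + count S                       ∎
    where
    open ≡-Reasoning
    incidence : Fin m → Fin n → Bool
    incidence e v = S e ∧ incident G e v
    endpoints : ∀ e → count (incidence e) ≡ bit (S e) + bit (S e)
    endpoints e with S e
    ... | false = count≡0 {f = λ v → false ∧ incident G e v} λ _ ()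
    ... | true  = trans (count-pair {f = incident G e} (loopless e) (Sum.map sym sym ∘ to incident⇔ends))
                    (cong₂ _+_ (cong bit (to T-≡ (from incident⇔ends (inj₁ refl))))
                               (cong bit (to T-≡ (from incident⇔ends (inj₂ refl)))))

  matched+unmatched : ∀ S → (∀ v → deg G S v ≤ 1) → (count S + count S) + count (λ v → deg G S v ≡ᵇ 0) ≡ n
  matched+unmatched S deg≤1 =
    trans (cong (_+ count (λ v → deg G S v ≡ᵇ 0)) (sym (handshake S))) (sum+zeros (deg G S) deg≤1)

-- The cycles of a 2-factor

module TwoFactor (G : Graph) (F : EdgeSet G) (isTwoFactor : IsTwoFactor G F) where
  open Graph G

  FEdgeAt : Fin n → Fin m → Set
  FEdgeAt w e = T (F e ∧ incident G e w)

  module _ {w : Fin n} {e : Fin m} where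

    FEdgeAt⇒F : FEdgeAt w e → T (F e)
    FEdgeAt⇒F = proj₁ ∘ to T-∧

    FEdgeAt⇒incident : FEdgeAt w e → T (incident G e w)
    FEdgeAt⇒incident = proj₂ ∘ to T-∧

  FEdgeAt-of-⊆ : ∀ {S : EdgeSet G} {e w} → (∀ e → T (S e) → T (F e)) → T (S e ∧ incident G e w) → FEdgeAt w e
  FEdgeAt-of-⊆ {S} {e} S⊆F S∧inc = let (s , inc) = to (T-∧ {S e}) S∧inc in from T-∧ (S⊆F e s , inc)

  FEdgeAt-other-end : ∀ {e u w} → FEdgeAt u e → Joins G e u w → FEdgeAt w e
  FEdgeAt-other-end f j = from T-∧ (FEdgeAt⇒F f , joins⇒incidentʳ G j)

  FEdgeAt-joins : ∀ {e w} → FEdgeAt w e → Joins G e w (otherEnd G e w)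
  FEdgeAt-joins = incident⇒joins G ∘ FEdgeAt⇒incident

  private
    fEdges : ∀ w → Σ (Fin m) λ a → Σ (Fin m) λ b → a ≢ b × FEdgeAt w a × FEdgeAt w b
    fEdges w = count≡2⇒ (isTwoFactor w)

  someFEdge : ∀ w → ∃ (FEdgeAt w)
  someFEdge w = let (a , _ , _ , fa , _) = fEdges w in a , fa

  opaque
    otherFEdge : Fin n → Fin m → Fin m
    otherFEdge w e with fEdges w
    ... | a , b , _ with e ≟ a
    ... | yes _ = b
    ... | no _  = a

    otherFEdge-spec : ∀ {w e} → FEdgeAt w e → FEdgeAt w (otherFEdge w e) × otherFEdge w e ≢ e
    otherFEdge-spec {w} {e} fe with fEdges w
    ... | a , b , a≢b , fa , fb with e ≟ a
    ... | yes refl = fb , a≢b ∘ sym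
    ... | no e≢a   = fa , e≢a ∘ sym

  FEdgeAt-cases : ∀ {w e e′} → FEdgeAt w e → FEdgeAt w e′ → e′ ≡ e ⊎ e′ ≡ otherFEdge w e
  FEdgeAt-cases fe fe′ = let (fo , o≢e) = otherFEdge-spec fe in
    count≡2-only (isTwoFactor _) (o≢e ∘ sym) fe fo fe′

  module Traversal (v₀ : Fin n) (e₀ : Fin m) (f₀ : FEdgeAt v₀ e₀) where

    step : Fin n × Fin m → Fin n × Fin m
    step (v , e) = otherEnd G e v , otherFEdge (otherEnd G e v) e

    state : ℕ → Fin n × Fin m
    state zero    = v₀ , e₀
    state (suc t) = step (state t)

    vertex : ℕ → Fin n
    vertex = proj₁ ∘ state

    edge : ℕ → Fin m
    edge = proj₂ ∘ state

    edge-at : ∀ t → FEdgeAt (vertex t) (edge t)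
    edge-joins : ∀ t → Joins G (edge t) (vertex t) (vertex (suc t))
    edge-at-next : ∀ t → FEdgeAt (vertex (suc t)) (edge t)
    edge-at zero    = f₀
    edge-at (suc t) = proj₁ (otherFEdge-spec (edge-at-next t))
    edge-joins t    = FEdgeAt-joins (edge-at t)
    edge-at-next t  = FEdgeAt-other-end (edge-at t) (edge-joins t)

    edge-in-F : ∀ t → T (F (edge t))
    edge-in-F t = FEdgeAt⇒F (edge-at t)

    next-edge-≢ : ∀ t → edge (suc t) ≢ edge t
    next-edge-≢ t = proj₂ (otherFEdge-spec (edge-at-next t))

    edges-at-next : ∀ t {e} → FEdgeAt (vertex (suc t)) e → e ≡ edge t ⊎ e ≡ edge (suc t)
    edges-at-next t = FEdgeAt-cases (edge-at-next t)

    vertex-back : ∀ t → otherEnd G (edge t) (vertex (suc t)) ≡ vertex t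
    vertex-back t = joins⇒otherEnd G (joins-sym G (edge-joins t))

    walk-to : ∀ t → Walk G F v₀ (vertex t)
    walk-to zero    = nil
    walk-to (suc t) = walk-++ G (walk-to t) (walk-edge G (edge t) (edge-in-F t) (edge-joins t))

    Repeats : ℕ → Set
    Repeats b = Σ (Fin b) λ a → vertex (toℕ a) ≡ vertex b

    repeats : ∀ {a b} → a < b → vertex a ≡ vertex b → Repeats b
    repeats a<b eq = fromℕ< a<b , trans (cong vertex (toℕ-fromℕ< a<b)) eq

    some-repeat : Σ ℕ Repeats
    some-repeat with pigeonhole (n<1+n n) (vertex ∘ toℕ {suc n})
    ... | a , b , a<b , eq = toℕ b , repeats a<b eq

    module _ {β : ℕ} (fresh : ∀ {c} → c < suc β → ¬ Repeats c) where

      -- Every vertex has exactly two F-edges, so the traversal can only close up at its start.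
      first-repeat-is-v₀ : ∀ {α} → α < suc β → vertex α ≡ vertex (suc β) → α ≡ 0
      first-repeat-is-v₀ {zero} _ _ = refl
      first-repeat-is-v₀ {suc α} (s≤s α<β) eq with edges-at-next α (subst (λ z → FEdgeAt z (edge β)) (sym eq) (edge-at-next β))
      ... | inj₁ eβ≡eα = ⊥-elim (fresh (n<1+n β) (repeats α<β (sym vβ≡vα)))
        where vβ≡vα = trans (sym (vertex-back β)) (trans (cong₂ (otherEnd G) eβ≡eα (sym eq)) (vertex-back α))
      ... | inj₂ eβ≡eα+1 with <-cmp (suc (suc α)) β
      ...   | tri< α+2<β _ _ = ⊥-elim (fresh (n<1+n β) (repeats α+2<β (sym vβ≡vα+2)))
        where vβ≡vα+2 = trans (sym (vertex-back β)) (cong₂ (otherEnd G) eβ≡eα+1 (sym eq))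
      ...   | tri≈ _ refl _ = ⊥-elim (next-edge-≢ (suc α) eβ≡eα+1)
      ...   | tri> _ _ β<α+2 with ≤-antisym (≤-pred β<α+2) α<β
      ...     | refl = ⊥-elim (joins⇒≢ G (edge-joins β) eq)

      closes-with-other-edge : vertex (suc β) ≡ v₀ → edge β ≢ e₀
      closes-with-other-edge = closes fresh
        where
        closes : ∀ {β} → (∀ {c} → c < suc β → ¬ Repeats c) → vertex (suc β) ≡ v₀ → edge β ≢ e₀
        closes {zero} _ v≡ _ = joins⇒≢ G (edge-joins 0) (sym v≡)
        closes {suc zero} _ _ e≡ = next-edge-≢ 0 e≡
        closes {suc (suc β)} fresh v≡ e≡ = fresh (n<1+n _) (repeats (s≤s (s≤s z≤n)) (sym vβ≡v₁))
          where vβ≡v₁ = trans (sym (vertex-back (suc (suc β)))) (cong₂ (otherEnd G) e≡ v≡)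

    record Period : Set where
      field
        last             : ℕ
        vertex-period    : vertex (suc last) ≡ v₀
        edge-period      : edge (suc last) ≡ e₀
        last-edge-≢      : edge last ≢ e₀
        vertex-injective : ∀ {a b} → a < suc last → b < suc last → vertex a ≡ vertex b → a ≡ b

    opaque
      period : Period
      period with minimal (λ b → any? λ a → vertex (toℕ a) ≟ vertex b) (proj₂ some-repeat)
      ... | zero , (() , _) , _
      ... | suc β , (a , va≡) , fresh = record
        { last             = β
        ; vertex-period    = vertex-period
        ; edge-period      = [ (λ e₀≡eβ → ⊥-elim (last-edge-≢ (sym e₀≡eβ))) , sym ]′
                               (edges-at-next β (subst (λ z → FEdgeAt z e₀) (sym vertex-period) f₀))
        ; last-edge-≢      = last-edge-≢
        ; vertex-injective = vertex-injective
        }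
        where
        vertex-period : vertex (suc β) ≡ v₀
        vertex-period = trans (sym va≡) (cong vertex (first-repeat-is-v₀ fresh (toℕ<n a) va≡))
        last-edge-≢ : edge β ≢ e₀
        last-edge-≢ = closes-with-other-edge fresh vertex-period
        vertex-injective : ∀ {a b} → a < suc β → b < suc β → vertex a ≡ vertex b → a ≡ b
        vertex-injective {a} {b} a< b< eq with <-cmp a b
        ... | tri< a<b _ _ = ⊥-elim (fresh b< (repeats a<b eq))
        ... | tri≈ _ a≡b _ = a≡b
        ... | tri> _ _ b<a = ⊥-elim (fresh a< (repeats b<a (sym eq)))

    open Period period public

    len : ℕ
    len = suc last

    OnCycle : Fin n → Set
    OnCycle u = Σ ℕ λ t → t < len × vertex t ≡ u

    prev : ℕ → ℕ
    prev zero    = last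
    prev (suc t) = t

    prev< : ∀ {t} → t < len → prev t < len
    prev< {zero}  _    = n<1+n last
    prev< {suc t} t+1< = <-trans (n<1+n t) t+1<

    vertex-after-prev : ∀ t → vertex (suc (prev t)) ≡ vertex t
    vertex-after-prev zero    = vertex-period
    vertex-after-prev (suc t) = refl

    edges-at : ∀ {t} → t < len → ∀ {e} → FEdgeAt (vertex t) e → e ≡ edge (prev t) ⊎ e ≡ edge t
    edges-at {zero} _ fe with edges-at-next last (subst (λ z → FEdgeAt z _) (sym vertex-period) fe)
    ... | inj₁ e≡ = inj₁ e≡
    ... | inj₂ e≡ = inj₂ (trans e≡ edge-period)
    edges-at {suc t} _ = edges-at-next t

    next-on-cycle : ∀ {t} → t < len → OnCycle (vertex (suc t))
    next-on-cycle {t} t< with m≤n⇒m<n∨m≡n t<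
    ... | inj₁ t+1< = suc t , t+1< , refl
    ... | inj₂ refl = 0 , s≤s z≤n , sym vertex-period

    neighbour-on-cycle : ∀ {t e w} → t < len → FEdgeAt (vertex t) e → Joins G e (vertex t) w → OnCycle w
    neighbour-on-cycle {t} t< fe j with edges-at t< fe
    ... | inj₁ refl = prev t , prev< t< ,
            trans (sym (vertex-back (prev t))) (trans (cong (otherEnd G _) (vertex-after-prev t)) (joins⇒otherEnd G j))
    ... | inj₂ refl = let (t′ , t′< , eq) = next-on-cycle t< in t′ , t′< , trans eq (joins⇒otherEnd G j)

    on-cycle-closed : ∀ {x u} → Walk G F x u → OnCycle x → OnCycle u
    on-cycle-closed nil c = c
    on-cycle-closed (cons e f j p) (t , t< , refl) =
      on-cycle-closed p (neighbour-on-cycle t< (from T-∧ (f , joins⇒incidentˡ G j)) j)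

    cycle : List (Fin n)
    cycle = tabulate {n = len} (vertex ∘ toℕ)

    cycle-length : CycleLength G F v₀ len
    cycle-length = cycle , unique , walk-to-member , member-of-walk , length-tabulate {n = len} (vertex ∘ toℕ)
      where
      unique : Unique cycle
      unique = tabulate⁺ {f = vertex ∘ toℕ} (λ eq → toℕ-injective (vertex-injective (toℕ<n _) (toℕ<n _) eq))
      walk-to-member : ∀ u → u ∈ cycle → Walk G F v₀ u
      walk-to-member u u∈ = let (i , u≡) = ∈-tabulate⁻ {f = vertex ∘ toℕ} u∈ in
        subst (Walk G F v₀) (sym u≡) (walk-to (toℕ i))
      member-of-walk : ∀ u → Walk G F v₀ u → u ∈ cycle
      member-of-walk u w = let (t , t< , vt≡u) = on-cycle-closed w (0 , s≤s z≤n , refl) in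
        subst (_∈ cycle) (trans (cong vertex (toℕ-fromℕ< t<)) vt≡u) (∈-tabulate⁺ {f = vertex ∘ toℕ} (fromℕ< t<))

    edges-distinct : ∀ {a b} → a < b → b < len → edge a ≢ edge b
    edges-distinct {a} {b} a<b b< eq
      with joins-incident G (edge-joins b) (subst (λ e → T (incident G e (vertex a))) eq (joins⇒incidentˡ G (edge-joins a)))
    ... | inj₁ va≡vb = <⇒≢ a<b (vertex-injective (<-trans a<b b<) b< va≡vb)
    ... | inj₂ va≡vb+1 with m≤n⇒m<n∨m≡n b<
    ...   | inj₁ b+1< = <⇒≢ (<-trans a<b (n<1+n b)) (vertex-injective (<-trans a<b b<) b+1< va≡vb+1)
    ...   | inj₂ refl with vertex-injective (<-trans a<b b<) (s≤s z≤n) (trans va≡vb+1 vertex-period)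
    ...     | refl = last-edge-≢ (sym eq)

    edge-injective : ∀ {a b} → a < len → b < len → edge a ≡ edge b → a ≡ b
    edge-injective {a} {b} a< b< eq with <-cmp a b
    ... | tri< a<b _ _ = ⊥-elim (edges-distinct a<b b< eq)
    ... | tri≈ _ a≡b _ = a≡b
    ... | tri> _ _ b<a = ⊥-elim (edges-distinct b<a a< (sym eq))

  cycle-length-unique : ∀ {v k k′} → CycleLength G F v k → CycleLength G F v k′ → k ≡ k′
  cycle-length-unique (l , ul , l⊆ , ⊆l , refl) (l′ , ul′ , l′⊆ , ⊆l′ , refl) =
    length-cong-⊆⊇ _≟_ ul ul′ (λ {z} z∈ → ⊆l′ z (l⊆ z z∈)) (λ {z} z∈ → ⊆l z (l′⊆ z z∈))

  cycle-length-along : ∀ {u w k} → Walk G F u w → CycleLength G F u k → CycleLength G F w k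
  cycle-length-along p (l , ul , l⊆ , ⊆l , len≡) =
    l , ul , (λ z z∈ → walk-++ G (walk-reverse G p) (l⊆ z z∈)) , (λ z q → ⊆l z (walk-++ G p q)) , len≡

  odd-along : ∀ {u w} → Walk G F u w → OnOddCycle G F u → OnOddCycle G F w
  odd-along p (k , c , odd) = k , cycle-length-along p c , odd

  even-along : ∀ {u w} → Walk G F u w → OnEvenCycle G F u → OnEvenCycle G F w
  even-along p (k , c , even) = k , cycle-length-along p c , even

  ¬odd×even : ∀ {v} → OnOddCycle G F v → OnEvenCycle G F v → ⊥
  ¬odd×even (k , c , odd) (k′ , c′ , even) with cycle-length-unique c c′
  ... | refl with trans (sym odd) even
  ... | ()

  odd-or-even : ∀ v → OnOddCycle G F v ⊎ OnEvenCycle G F v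
  odd-or-even v = let (e , fe) = someFEdge v in by-parity (Traversal.cycle-length v e fe)
    where
    by-parity : ∀ {k} → CycleLength G F v k → OnOddCycle G F v ⊎ OnEvenCycle G F v
    by-parity {k} c with k % 2 in k%2≡ | m%n<n k 2
    ... | 0           | _            = inj₂ (k , c , k%2≡)
    ... | 1           | _            = inj₁ (k , c , k%2≡)
    ... | suc (suc _) | s≤s (s≤s ())

-- The maximum matching M

module Construction
  (G : Graph) (F : EdgeSet G) (isTwoFactor : IsTwoFactor G F)
  (Meven : EdgeSet G) (Meven-perfect : IsPerfectMatchingOfFeven G F Meven)
  (p : ℕ) (P : Fin p → Path G (_∖_ G (allEdges G) Meven))
  (P-Kodd : ∀ i → IsKoddEdge G F Meven (P i))
  (P-covers : ∀ v → OnOddCycle G F v → ∃[ i ] ∃[ s ] Walk G F v (endpoint (P i) s))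
  (P-separated : ∀ i j s t → Walk G F (endpoint (P i) s) (endpoint (P j) t) → (i ≡ j) × (s ≡ t))
  where

  open Graph G
  open TwoFactor G F isTwoFactor

  y : Fin p → Bool → Fin n
  y i s = endpoint (P i) s

  y-odd : ∀ i s → OnOddCycle G F (y i s)
  y-odd i s = proj₁ (P-Kodd i) s

  g : Fin p → Bool → Fin m
  g i s = proj₁ (someFEdge (y i s))

  x : Fin p → Bool → Fin n
  x i s = otherEnd G (g i s) (y i s)

  g-joins : ∀ i s → Joins G (g i s) (y i s) (x i s)
  g-joins i s = FEdgeAt-joins (proj₂ (someFEdge (y i s)))

  g-in-F : ∀ i s → T (F (g i s))
  g-in-F i s = FEdgeAt⇒F (proj₂ (someFEdge (y i s)))

  x-y-walk : ∀ i s → Walk G F (x i s) (y i s)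
  x-y-walk i s = walk-edge G (g i s) (g-in-F i s) (joins-sym G (g-joins i s))

  module C (i : Fin p) (s : Bool) =
    Traversal (x i s) (g i s) (FEdgeAt-other-end (proj₂ (someFEdge (y i s))) (g-joins i s))

  OnCycleOf : Fin p → Bool → Fin n → Set
  OnCycleOf i s = Walk G F (x i s)

  on-cycle-odd : ∀ i s {w} → OnCycleOf i s w → OnOddCycle G F w
  on-cycle-odd i s c = odd-along (walk-++ G (walk-reverse G (x-y-walk i s)) c) (y-odd i s)

  same-cycle : ∀ {i s j t w} → OnCycleOf i s w → OnCycleOf j t w → i ≡ j × s ≡ t
  same-cycle {i} {s} {j} {t} c c′ = P-separated i j s t
    (walk-++ G (walk-reverse G (x-y-walk i s)) (walk-++ G c (walk-++ G (walk-reverse G c′) (x-y-walk j t))))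

  last-even : ∀ i s → parity (C.last i s) ≡ 0ℙ
  last-even i s = let (k , c , odd) = on-cycle-odd i s nil in
    suc-odd⇒even {C.last i s} (subst (λ k → k % 2 ≡ 1) (cycle-length-unique c (C.cycle-length i s)) odd)

  -- The cycle traversed from x i s is odd, so its edges in odd positions match all its vertices but x i s.
  OddPosition : Fin p → Bool → Fin m → Set
  OddPosition i s e = Σ (Fin (C.len i s)) λ t → parity (toℕ t) ≡ 1ℙ × C.edge i s (toℕ t) ≡ e

  InOddPart : Fin m → Set
  InOddPart e = Σ (Fin p) λ i → Σ Bool λ s → OddPosition i s e

  opaque
    oddPart : EdgeSet G
    oddPart e = ⌊ any? (λ i → any-Bool? λ s → any? {n = C.len i s} λ t →
                    (parity (toℕ t) Parity.≟ 1ℙ) ×-dec (C.edge i s (toℕ t) ≟ e)) ⌋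

    oddPart⇔ : ∀ {e} → T (oddPart e) ⇔ InOddPart e
    oddPart⇔ = mk⇔ toWitness fromWitness

  M : EdgeSet G
  M e = Meven e ∨ oddPart e

  odd-position-on-cycle : ∀ {i s e w} → OddPosition i s e → T (incident G e w) → OnCycleOf i s w
  odd-position-on-cycle {i} {s} {w = w} (t , _ , e≡) inc =
    [ (λ w≡ → subst (OnCycleOf i s) (sym w≡) (C.walk-to i s (toℕ t))) ,
      (λ w≡ → subst (OnCycleOf i s) (sym w≡) (C.walk-to i s (suc (toℕ t)))) ]′
    (joins-incident G (C.edge-joins i s (toℕ t)) (subst (λ e → T (incident G e w)) (sym e≡) inc))
  Meven-ends-even : ∀ {e w} → T (Meven e) → T (incident G e w) → OnEvenCycle G F w
  Meven-ends-even {e} me inc with to (incident⇔ends G) inc | proj₁ Meven-perfect e me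
  ... | inj₁ refl | _ , even , _ = even
  ... | inj₂ refl | _ , _ , even = even

  M-in-F : ∀ e → T (M e) → T (F e)
  M-in-F e Me with to T-∨ Me
  ... | inj₁ me = proj₁ (proj₁ Meven-perfect e me)
  ... | inj₂ mo = let (i , s , t , _ , eq) = to oddPart⇔ mo in subst (T ∘ F) eq (C.edge-in-F i s (toℕ t))

  deg-M-even : ∀ v → OnEvenCycle G F v → deg G M v ≡ 1
  deg-M-even v even =
    trans (count-cong {f = λ e → M e ∧ incident G e v} {g = λ e → Meven e ∧ incident G e v} only-Meven)
          (proj₂ Meven-perfect v even)
    where
    odd-not-even : ∀ {e} → InOddPart e → T (incident G e v) → ⊥
    odd-not-even {e} (i , s , pos) inc = ¬odd×even (on-cycle-odd i s (odd-position-on-cycle {i} {s} {e} {v} pos inc)) even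
    only-Meven : ∀ e → (M e ∧ incident G e v) ≡ (Meven e ∧ incident G e v)
    only-Meven e = ∨-∧-disjoint (Meven e) (oddPart e) (incident G e v) (λ op inc → odd-not-even (to (oddPart⇔ {e}) op) inc)

  M-along-cycle : ∀ i s {t} → t < C.len i s → T (M (C.edge i s t)) ⇔ parity t ≡ 1ℙ
  M-along-cycle i s {t} t< = mk⇔ odd-index odd-index⁻¹
    where
    e = C.edge i s t
    incident-t : T (incident G e (C.vertex i s t))
    incident-t = joins⇒incidentˡ G (C.edge-joins i s t)
    odd-part-index : InOddPart e → parity t ≡ 1ℙ
    odd-part-index (j , s′ , pos) =
      let (j≡i , s′≡s) = same-cycle {j} {s′} {i} {s}
                           (odd-position-on-cycle {j} {s′} {e} {C.vertex i s t} pos incident-t) (C.walk-to i s t)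
          (t′ , odd , eq) = subst₂ (λ j s′ → OddPosition j s′ e) j≡i s′≡s pos
      in subst (λ z → parity z ≡ 1ℙ) (C.edge-injective i s (toℕ<n t′) t< eq) odd
    odd-index : T (M e) → parity t ≡ 1ℙ
    odd-index Me =
      [ (λ me → ⊥-elim (¬odd×even (on-cycle-odd i s (C.walk-to i s t)) (Meven-ends-even {e} {C.vertex i s t} me incident-t))) ,
        odd-part-index ∘ to (oddPart⇔ {e}) ]′ (to T-∨ Me)
    odd-index⁻¹ : parity t ≡ 1ℙ → T (M e)
    odd-index⁻¹ odd = from T-∨ (inj₂ (from (oddPart⇔ {e}) (i , s , fromℕ< t< ,
      subst (λ z → parity z ≡ 1ℙ) (sym (toℕ-fromℕ< t<)) odd , cong (C.edge i s) (toℕ-fromℕ< t<))))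

  deg-M-x : ∀ i s → deg G M (x i s) ≡ 0
  deg-M-x i s = count≡0 {f = λ e → M e ∧ incident G e (x i s)} λ e Me∧inc →
    [ (λ e≡ → even-last (subst (T ∘ M) e≡ (proj₁ (to T-∧ Me∧inc)))) ,
      (λ e≡ → even-first (subst (T ∘ M) e≡ (proj₁ (to T-∧ Me∧inc)))) ]′
    (C.edges-at i s (s≤s z≤n) (FEdgeAt-of-⊆ {M} {e} {x i s} M-in-F Me∧inc))
    where
    even-last : ¬ T (M (C.edge i s (C.last i s)))
    even-last Me = 0ℙ≢1ℙ (trans (sym (last-even i s)) (to (M-along-cycle i s (n<1+n (C.last i s))) Me))
    even-first : ¬ T (M (C.edge i s 0))
    even-first Me = 0ℙ≢1ℙ (to (M-along-cycle i s (s≤s z≤n)) Me)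

  deg-M-later : ∀ i s {t} → suc t < C.len i s → deg G M (C.vertex i s (suc t)) ≡ 1
  deg-M-later i s {t} t+1< = begin
    count (λ e → M e ∧ incident G e v)
      ≡⟨ count-pair {f = λ e → M e ∧ incident G e v} (C.next-edge-≢ i s t ∘ sym)
                    (λ {e} → C.edges-at-next i s t ∘ FEdgeAt-of-⊆ {M} {e} {v} M-in-F) ⟩
    bit (M e₁ ∧ incident G e₁ v) + bit (M e₂ ∧ incident G e₂ v)
      ≡⟨ cong₂ _+_ (bit-⇔ (⇔.trans (T-∧-true {M e₁} inc₁) (M-along-cycle i s (<-trans (n<1+n t) t+1<))))
                   (bit-⇔ (⇔.trans (T-∧-true {M e₂} inc₂) (M-along-cycle i s t+1<))) ⟩
    oddBit (parity t) + oddBit (parity (suc t))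
      ≡⟨ cong (λ q → oddBit (parity t) + oddBit q) (parity-suc t) ⟩
    oddBit (parity t) + oddBit (parity t ⁻¹)
      ≡⟨ oddBit+oddBit⁻¹ (parity t) ⟩
    1 ∎
    where
    v  = C.vertex i s (suc t)
    e₁ = C.edge i s t
    e₂ = C.edge i s (suc t)
    inc₁ : T (incident G e₁ v)
    inc₁ = FEdgeAt⇒incident (C.edge-at-next i s t)
    inc₂ : T (incident G e₂ v)
    inc₂ = FEdgeAt⇒incident (C.edge-at i s (suc t))
    open ≡-Reasoning

  IsX : Fin n → Set
  IsX v = Σ (Fin p) λ i → Σ Bool λ s → v ≡ x i s

  deg-M-cases : ∀ v → deg G M v ≡ 1 ⊎ IsX v
  deg-M-cases v = [ on-odd-cycle , inj₁ ∘ deg-M-even v ]′ (odd-or-even v)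
    where
    by-position : ∀ i s t → t < C.len i s → C.vertex i s t ≡ v → deg G M v ≡ 1 ⊎ IsX v
    by-position i s zero    _  vt≡v = inj₂ (i , s , sym vt≡v)
    by-position i s (suc t) t< vt≡v = inj₁ (subst (λ z → deg G M z ≡ 1) vt≡v (deg-M-later i s t<))
    on-odd-cycle : OnOddCycle G F v → deg G M v ≡ 1 ⊎ IsX v
    on-odd-cycle odd =
      let (i , s , v~y) = P-covers v odd
          (t , t< , vt≡v) = C.on-cycle-closed i s (walk-++ G (x-y-walk i s) (walk-reverse G v~y)) (0 , s≤s z≤n , refl)
      in by-position i s t t< vt≡v

  deg-M≤1 : ∀ v → deg G M v ≤ 1
  deg-M≤1 v = [ ≤-reflexive , (λ (i , s , v≡) → subst (_≤ 1) (sym (trans (cong (deg G M) v≡) (deg-M-x i s))) z≤n) ]′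
                (deg-M-cases v)

  M-matching : IsMatchingIn G F M
  M-matching = M-in-F , deg-M≤1

  x-injective : ∀ {i s j t} → x i s ≡ x j t → i ≡ j × s ≡ t
  x-injective {i} {s} {j} {t} x≡ = same-cycle {i} {s} {j} {t} nil (subst (OnCycleOf j t) (sym x≡) nil)

  unmatched-by-M : count (λ v → deg G M v ≡ᵇ 0) ≡ p + p
  unmatched-by-M = trans
    (count≡length (bothSides⁺ x x-injective)
      (λ v∈ → let (i , s , v≡) = ∈-bothSides⁻ x v∈ in ≡⇒≡ᵇ _ 0 (trans (cong (deg G M) v≡) (deg-M-x i s)))
      (λ {v} unmatched → [ (λ deg≡1 → ⊥-elim (1≢0 (trans (sym deg≡1) (≡ᵇ⇒≡ _ 0 unmatched)))) ,
                           (λ (i , s , v≡) → subst (_∈ bothSides x) (sym v≡) (∈-bothSides⁺ x i s)) ]′ (deg-M-cases v)))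
    (length-bothSides x)
    where
    1≢0 : 1 ≢ 0
    1≢0 ()

  module _ (M′ : EdgeSet G) (M′-matching : IsMatchingIn G F M′) where

    private
      M′-in-F = proj₁ M′-matching
      deg-M′≤1 = proj₂ M′-matching

    deg-M′-along : ∀ i s t → deg G M′ (C.vertex i s (suc t)) ≡ bit (M′ (C.edge i s t)) + bit (M′ (C.edge i s (suc t)))
    deg-M′-along i s t =
      trans (count-pair {f = λ e → M′ e ∧ incident G e v} (C.next-edge-≢ i s t ∘ sym)
                        (λ {e} → C.edges-at-next i s t ∘ FEdgeAt-of-⊆ {M′} {e} {v} M′-in-F))
            (cong₂ _+_ (cong bit (∧-true (M′ e₁) (incident G e₁ v) (FEdgeAt⇒incident (C.edge-at-next i s t))))
                       (cong bit (∧-true (M′ e₂) (incident G e₂ v) (FEdgeAt⇒incident (C.edge-at i s (suc t))))))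
      where
      v  = C.vertex i s (suc t)
      e₁ = C.edge i s t
      e₂ = C.edge i s (suc t)
      ∧-true : ∀ a b → T b → (a ∧ b) ≡ a
      ∧-true a b tb = trans (cong (a ∧_) (to T-≡ tb)) (∧-identityʳ a)

    -- A perfect matching of a cycle alternates along it, which an odd cycle does not allow.
    not-perfect-on-cycle : ∀ i s → ¬ (∀ {t} → t < C.len i s → deg G M′ (C.vertex i s t) ≡ 1)
    not-perfect-on-cycle i s perfect = b≢not-b (b 0) (begin
      b 0                  ≡⟨ cong M′ (sym (C.edge-period i s)) ⟩
      b (suc (C.last i s)) ≡⟨ alternating-period b flips (last-even i s) ⟩
      not (b 0)            ∎)
      where
      b : ℕ → Bool
      b t = M′ (C.edge i s t)
      flips : ∀ {t} → t < C.len i s → b (suc t) ≡ not (b t)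
      flips {t} t< = let (t′ , t′< , vt′≡) = C.next-on-cycle i s t< in
        bit+bit≡1 (trans (sym (deg-M′-along i s t)) (trans (cong (deg G M′) (sym vt′≡)) (perfect t′<)))
      b≢not-b : ∀ a → a ≢ not a
      b≢not-b false ()
      b≢not-b true ()
      open ≡-Reasoning

    unmatched-on-cycle : ∀ i s → Σ ℕ λ t → t < C.len i s × deg G M′ (C.vertex i s t) ≡ 0
    unmatched-on-cycle i s = from-search (any? λ t → deg G M′ (C.vertex i s (toℕ t)) ℕ.≟ 0)
      where
      Unmatched : ℕ → Set
      Unmatched t = deg G M′ (C.vertex i s t) ≡ 0
      from-search : Dec (∃ λ (t : Fin (C.len i s)) → Unmatched (toℕ t)) → Σ ℕ λ t → t < C.len i s × Unmatched t
      from-search (yes (t , unmatched)) = toℕ t , toℕ<n t , unmatched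
      from-search (no none) = ⊥-elim (not-perfect-on-cycle i s λ {t} t< →
        [ (λ unmatched → ⊥-elim (none (fromℕ< t< , subst Unmatched (sym (toℕ-fromℕ< t<)) unmatched))) , (λ matched → matched) ]′
        (n≤1⇒n≡0∨n≡1 (deg-M′≤1 _)))

    free-position : Fin p → Bool → ℕ
    free-position i s = proj₁ (unmatched-on-cycle i s)

    free : Fin p → Bool → Fin n
    free i s = C.vertex i s (free-position i s)

    free-injective : ∀ {i s j t} → free i s ≡ free j t → i ≡ j × s ≡ t
    free-injective {i} {s} {j} {t} free≡ = same-cycle {i} {s} {j} {t} (C.walk-to i s (free-position i s))
      (subst (OnCycleOf j t) (sym free≡) (C.walk-to j t (free-position j t)))

    unmatched-by-M′ : p + p ≤ count (λ v → deg G M′ v ≡ᵇ 0)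
    unmatched-by-M′ = subst (_≤ count unmatched) (length-bothSides free)
      (length≤count {f = unmatched} (bothSides⁺ free free-injective) λ {v} v∈ →
        let (i , s , v≡) = ∈-bothSides⁻ free v∈ in
        ≡⇒≡ᵇ (deg G M′ v) 0 (trans (cong (deg G M′) v≡) (proj₂ (proj₂ (unmatched-on-cycle i s)))))
      where
      unmatched : Fin n → Bool
      unmatched v = deg G M′ v ≡ᵇ 0

    M-maximum : count M′ ≤ count M
    M-maximum = +-double-cancel-≤ (+-cancelʳ-≤ z′ (count M′ + count M′) (count M + count M) (begin
      (count M′ + count M′) + z′ ≡⟨ matched+unmatched G M′ deg-M′≤1 ⟩
      n                          ≡⟨ sym (matched+unmatched G M deg-M≤1) ⟩
      (count M + count M) + z    ≤⟨ +-monoʳ-≤ (count M + count M) (subst (_≤ z′) (sym unmatched-by-M) unmatched-by-M′) ⟩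
      (count M + count M) + z′   ∎))
      where
      z  = count (λ v → deg G M v ≡ᵇ 0)
      z′ = count (λ v → deg G M′ v ≡ᵇ 0)
      open ≤-Reasoning

-- Paths

_∷ʳ_ : ∀ {A : Set} {k} → (Fin k → A) → A → Fin (suc k) → A
(f ∷ʳ a) i with view i
... | ‵fromℕ          = a
... | ‵inj₁ {i = j} _ = f j

∷ʳ-inject₁ : ∀ {A : Set} {k} (f : Fin k → A) a j → (f ∷ʳ a) (inject₁ j) ≡ f j
∷ʳ-inject₁ f a j rewrite view-inject₁ j = refl

∷ʳ-fromℕ : ∀ {A : Set} {k} (f : Fin k → A) a → (f ∷ʳ a) (fromℕ k) ≡ a
∷ʳ-fromℕ {k = k} f a rewrite view-fromℕ k = refl

below-last : ∀ {κ} (b : Fin (suc κ)) → b ≢ fromℕ κ → Σ (Fin κ) λ b₁ → inject₁ b₁ ≡ b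
below-last b b≢last with view b
... | ‵fromℕ          = ⊥-elim (b≢last refl)
... | ‵inj₁ {i = b₁} _ = b₁ , refl

pathIn : ∀ {G : Graph} {S : EdgeSet G} (S′ : EdgeSet G) (P : Path G S) → (∀ c → T (S′ (es P c))) → Path G S′
pathIn S′ P inS′ = record { k = k P ; vs = vs P ; es = es P ; inS = inS′ ; joins = joins P ; injVs = injVs P }

module _ (G : Graph) {S : EdgeSet G} (P : Path G S) where
  open Graph G

  module Extension {xf xt : Fin n} {ef et : Fin m} (ef∈S : T (S ef)) (et∈S : T (S et))
    (jf : Joins G ef xf (endpoint P false)) (jt : Joins G et (endpoint P true) xt)
    (xf∉P : ∀ a → vs P a ≢ xf) (xt∉P : ∀ a → vs P a ≢ xt) (xf≢xt : xf ≢ xt) where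

    private
      κ = k P

      joins-congˡ : ∀ {e u u′ w} → u ≡ u′ → Joins G e u w → Joins G e u′ w
      joins-congˡ refl j = j

    ext-vs : Fin (suc (suc (suc (suc κ)))) → Fin n
    ext-vs zero    = xf
    ext-vs (suc b) = (vs P ∷ʳ xt) b

    ext-es : Fin (suc (suc (suc κ))) → Fin m
    ext-es zero    = ef
    ext-es (suc c) = (es P ∷ʳ et) c

    ext-inS : ∀ c → T (S (ext-es c))
    ext-inS zero = ef∈S
    ext-inS (suc c) with view c
    ... | ‵fromℕ          = et∈S
    ... | ‵inj₁ {i = j} _ = inS P j

    -- Abstracting view c makes (f ∷ʳ a) c and (f ∷ʳ a) (suc c) compute; only (f ∷ʳ a) (inject₁ c) does not.
    ext-joins : ∀ c → Joins G (ext-es c) (ext-vs (inject₁ c)) (ext-vs (suc c))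
    ext-joins zero = jf
    ext-joins (suc c) with view c
    ... | ‵fromℕ          = joins-congˡ (sym (∷ʳ-inject₁ (vs P) xt (fromℕ (suc κ)))) jt
    ... | ‵inj₁ {i = j} _ = joins-congˡ (sym (∷ʳ-inject₁ (vs P) xt (inject₁ j))) (joins P j)

    data Position : Fin (suc (suc (suc (suc κ)))) → Set where
      first : Position zero
      last  : Position (fromℕ (suc (suc (suc κ))))
      inner : ∀ a → Position (suc (inject₁ a))

    position : ∀ b → Position b
    position zero = first
    position (suc b) with view b
    ... | ‵fromℕ          = last
    ... | ‵inj₁ {i = a} _ = inner a

    ext-vs-last : ext-vs (fromℕ (suc (suc (suc κ)))) ≡ xt
    ext-vs-last = ∷ʳ-fromℕ (vs P) xt

    ext-vs-inner : ∀ a → ext-vs (suc (inject₁ a)) ≡ vs P a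
    ext-vs-inner = ∷ʳ-inject₁ (vs P) xt

    ext-injVs : ∀ a b → ext-vs a ≡ ext-vs b → a ≡ b
    ext-injVs a b eq with position a | position b
    ... | first    | first    = refl
    ... | first    | last     = ⊥-elim (xf≢xt (trans eq ext-vs-last))
    ... | first    | inner b′ = ⊥-elim (xf∉P b′ (sym (trans eq (ext-vs-inner b′))))
    ... | last     | first    = ⊥-elim (xf≢xt (trans (sym eq) ext-vs-last))
    ... | last     | last     = refl
    ... | last     | inner b′ = ⊥-elim (xt∉P b′ (trans (sym (ext-vs-inner b′)) (trans (sym eq) ext-vs-last)))
    ... | inner a′ | first    = ⊥-elim (xf∉P a′ (trans (sym (ext-vs-inner a′)) eq))
    ... | inner a′ | last     = ⊥-elim (xt∉P a′ (trans (sym (ext-vs-inner a′)) (trans eq ext-vs-last)))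
    ... | inner a′ | inner b′ =
      cong (suc ∘ inject₁) (injVs P a′ b′ (trans (sym (ext-vs-inner a′)) (trans eq (ext-vs-inner b′))))

    extend : Path G S
    extend = record
      { k = suc (suc κ) ; vs = ext-vs ; es = ext-es ; inS = ext-inS ; joins = ext-joins ; injVs = ext-injVs }

    extend-interior : ∀ b → Interior extend b → Σ (Fin (suc (suc κ))) λ a → vs extend b ≡ vs P a
    extend-interior b (b≢first , b≢last) with position b
    ... | first   = ⊥-elim (b≢first refl)
    ... | last    = ⊥-elim (b≢last refl)
    ... | inner a = a , ext-vs-inner a

    extend-edges : ∀ c → c ≡ firstEdge extend ⊎ c ≡ lastEdge extend ⊎ Σ (Fin (suc κ)) λ c′ → es extend c ≡ es P c′
    extend-edges zero = inj₁ refl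
    extend-edges (suc c) with view c
    ... | ‵fromℕ          = inj₂ (inj₁ refl)
    ... | ‵inj₁ {i = c′} _ = inj₂ (inj₂ (c′ , refl))

    extend-last-edge : es extend (lastEdge extend) ≡ et
    extend-last-edge = ∷ʳ-fromℕ (es P) et

  interior-neighbour : ∀ {b e w} → Interior P b → deg G S (vs P b) ≡ 2 → T (S e) → Joins G e (vs P b) w →
    Σ (Fin (suc (suc (k P)))) λ c → vs P c ≡ w
  interior-neighbour {zero} (b≢first , _) = ⊥-elim (b≢first refl)
  interior-neighbour {suc b₀} {e} {w} (_ , b≢last) deg≡2 e∈S j
    with below-last (suc b₀) b≢last
  ... | b₁ , b₁≡ = [ (λ e≡e₀ → inject₁ b₀ , sym (other-end e≡e₀ (joins-sym G (joins P b₀))))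
                   , (λ e≡e₁ → suc b₁ , sym (other-end e≡e₁
                                  (subst (λ z → Joins G e₁ (vs P z) (vs P (suc b₁))) b₁≡ (joins P b₁)))) ]′
                   (count≡2-only deg≡2 e₀≢e₁ (at-w e₀ (inS P b₀) (joins⇒incidentʳ G (joins P b₀)))
                                            (at-w e₁ (inS P b₁)
                                              (subst (λ z → T (incident G e₁ (vs P z))) b₁≡ (joins⇒incidentˡ G (joins P b₁))))
                                            (at-w e e∈S (joins⇒incidentˡ G j)))
    where
    e₀ = es P b₀
    e₁ = es P b₁
    at-w : ∀ e′ → T (S e′) → T (incident G e′ (vs P (suc b₀))) → T (S e′ ∧ incident G e′ (vs P (suc b₀)))
    at-w e′ s inc = from T-∧ (s , inc)
    other-end : ∀ {e′ w′} → e ≡ e′ → Joins G e′ (vs P (suc b₀)) w′ → w ≡ w′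
    other-end refl j′ = trans (sym (joins⇒otherEnd G j)) (joins⇒otherEnd G j′)
    toℕ-b₁ : toℕ b₁ ≡ suc (toℕ b₀)
    toℕ-b₁ = trans (sym (toℕ-inject₁ b₁)) (cong toℕ b₁≡)
    e₀≢e₁ : e₀ ≢ e₁
    e₀≢e₁ eq with joins-incident G (joins P b₁)
                    (subst (λ e′ → T (incident G e′ (vs P (inject₁ b₀)))) eq (joins⇒incidentˡ G (joins P b₀)))
    ... | inj₁ same = 1+n≢n (sym (trans (sym (toℕ-inject₁ b₀))
                        (trans (cong toℕ (injVs P _ _ same)) (trans (toℕ-inject₁ b₁) toℕ-b₁))))
    ... | inj₂ same = <⇒≢ (<-trans (n<1+n _) (n<1+n _))
                        (trans (sym (toℕ-inject₁ b₀)) (trans (cong toℕ (injVs P _ _ same)) (cong suc toℕ-b₁)))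

-- The simple F-matching

module SimpleFMatching
  (G : Graph) (cubic : Cubic G) (F : EdgeSet G) (isTwoFactor : IsTwoFactor G F)
  (Meven : EdgeSet G) (Meven-perfect : IsPerfectMatchingOfFeven G F Meven)
  (p : ℕ) (P : Fin p → Path G (_∖_ G (allEdges G) Meven))
  (P-Kodd : ∀ i → IsKoddEdge G F Meven (P i))
  (P-covers : ∀ v → OnOddCycle G F v → ∃[ i ] ∃[ s ] Walk G F v (endpoint (P i) s))
  (P-separated : ∀ i j s t → Walk G F (endpoint (P i) s) (endpoint (P j) t) → (i ≡ j) × (s ≡ t))
  where

  open Graph G
  open TwoFactor G F isTwoFactor
  open Construction G F isTwoFactor Meven Meven-perfect p P P-Kodd P-covers P-separated

  H Hodd : EdgeSet G
  H    = _∖_ G (allEdges G) M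
  Hodd = _∖_ G (allEdges G) Meven

  deg-M+deg-H : ∀ v → deg G M v + deg G H v ≡ 3
  deg-M+deg-H v = trans (sym (deg-complement G M v)) (cubic v)

  deg-H-x : ∀ i s → deg G H (x i s) ≡ 3
  deg-H-x i s = trans (cong (_+ deg G H (x i s)) (sym (deg-M-x i s))) (deg-M+deg-H (x i s))

  deg-H-matched : ∀ {v} → deg G M v ≡ 1 → deg G H v ≡ 2
  deg-H-matched {v} deg≡1 = suc-injective (trans (cong (_+ deg G H v) (sym deg≡1)) (deg-M+deg-H v))

  deg-H-3⇒x : ∀ {v} → deg G H v ≡ 3 → IsX v
  deg-H-3⇒x {v} deg≡3 =
    [ (λ deg≡1 → ⊥-elim (2≢3 (trans (sym (deg-H-matched deg≡1)) deg≡3))) , (λ isX → isX) ]′ (deg-M-cases v)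
    where
    2≢3 : 2 ≢ 3
    2≢3 ()

  deg-Hodd-even : ∀ {w} → OnEvenCycle G F w → deg G Hodd w ≡ 2
  deg-Hodd-even {w} even = suc-injective (trans (cong (_+ deg G Hodd w) (sym (proj₂ Meven-perfect w even)))
                                                (trans (sym (deg-complement G Meven w)) (cubic w)))

  interior-even : ∀ i {a} → Interior (P i) a → OnEvenCycle G F (vs (P i) a)
  interior-even i = proj₁ (proj₂ (P-Kodd i)) _

  AtEnd : ∀ i → Fin (suc (suc (k (P i)))) → Set
  AtEnd i a = Σ Bool λ s → vs (P i) a ≡ y i s

  P-vertex-kind : ∀ i a → AtEnd i a ⊎ Interior (P i) a
  P-vertex-kind i a with a ≟ zero | a ≟ fromℕ (suc (k (P i)))
  ... | yes a≡first | _           = inj₁ (false , cong (vs (P i)) a≡first)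
  ... | no _        | yes a≡last  = inj₁ (true , cong (vs (P i)) a≡last)
  ... | no a≢first  | no a≢last   = inj₂ (a≢first , a≢last)

  P-vertex-not-x : ∀ i a j s → vs (P i) a ≢ x j s
  P-vertex-not-x i a j s v≡x =
    [ at-end , (λ int → ¬odd×even (on-cycle-odd j s (subst (OnCycleOf j s) (sym v≡x) nil)) (interior-even i int)) ]′
    (P-vertex-kind i a)
    where
    at-end : AtEnd i a → ⊥
    at-end (s′ , v≡y) =
      let x≡y = trans (sym v≡x) v≡y
          (j≡i , s≡s′) = same-cycle {j} {s} {i} {s′} (subst (OnCycleOf j s) x≡y nil) (x-y-walk i s′)
      in joins⇒≢ G (g-joins i s′) (trans (sym x≡y) (subst₂ (λ j s → x j s ≡ x i s′) (sym j≡i) (sym s≡s′) refl))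

  deg-M-on-P : ∀ i a → deg G M (vs (P i) a) ≡ 1
  deg-M-on-P i a = [ (λ deg≡1 → deg≡1) , (λ (j , s , v≡x) → ⊥-elim (P-vertex-not-x i a j s v≡x)) ]′ (deg-M-cases (vs (P i) a))

  g-not-in-M : ∀ i s → ¬ T (M (g i s))
  g-not-in-M i s Mg = count≡0⇒ {f = λ e → M e ∧ incident G e (x i s)} (deg-M-x i s) (g i s)
    (from T-∧ (Mg , joins⇒incidentʳ G (g-joins i s)))

  -- An F-edge of P i with no interior end would join the ends of P i, which lie on distinct odd cycles.
  P-F-edge-even : ∀ i c → T (F (es (P i) c)) → ∀ {z} → T (incident G (es (P i) c) z) → OnEvenCycle G F z
  P-F-edge-even i c e∈F {z} inc =
    [ (λ z≡left → subst (OnEvenCycle G F) (sym z≡left) even-left) ,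
      (λ z≡right → subst (OnEvenCycle G F) (sym z≡right) (even-along left~right even-left)) ]′
    (joins-incident G (joins (P i) c) inc)
    where
    left  = vs (P i) (inject₁ c)
    right = vs (P i) (suc c)
    left~right : Walk G F left right
    left~right = walk-edge G (es (P i) c) e∈F (joins (P i) c)
    both-ends : ∀ {s s′} → left ≡ y i s → right ≡ y i s′ → ⊥
    both-ends {s} {s′} left≡y right≡y with P-separated i i s s′ (subst₂ (Walk G F) left≡y right≡y left~right)
    ... | _ , refl = 1+n≢n (sym (trans (sym (toℕ-inject₁ c)) (cong toℕ (injVs (P i) _ _ (trans left≡y (sym right≡y))))))
    even-left : OnEvenCycle G F left
    even-left with P-vertex-kind i (inject₁ c) | P-vertex-kind i (suc c)
    ... | inj₂ int | _        = interior-even i int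
    ... | inj₁ _   | inj₂ int = even-along (walk-reverse G left~right) (interior-even i int)
    ... | inj₁ (s , left≡y) | inj₁ (s′ , right≡y) = ⊥-elim (both-ends {s} {s′} left≡y right≡y)

  P-edge-not-in-M : ∀ i c → ¬ T (M (es (P i) c))
  P-edge-not-in-M i c Me =
    [ (λ me → subst T (to T-not-≡ (inS (P i) c)) me) ,
      (λ mo → let (j , s , pos) = to (oddPart⇔ {e}) mo in
        ¬odd×even (on-cycle-odd j s (odd-position-on-cycle {j} {s} {e} {vs (P i) (inject₁ c)} pos inc))
                  (P-F-edge-even i c (M-in-F e Me) inc)) ]′
    (to T-∨ Me)
    where
    e = es (P i) c
    inc : T (incident G e (vs (P i) (inject₁ c)))
    inc = joins⇒incidentˡ G (joins (P i) c)

  x-distinct-sides : ∀ i → x i false ≢ x i true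
  x-distinct-sides i x≡ with () ← proj₂ (x-injective {i} {false} {i} {true} x≡)

  P-in-H : Fin p → Path G H
  P-in-H i = pathIn H (P i) (λ c → ¬T⇒T-not (P-edge-not-in-M i c))

  module Ext (i : Fin p) = Extension G (P-in-H i)
    (¬T⇒T-not (g-not-in-M i false)) (¬T⇒T-not (g-not-in-M i true))
    (joins-sym G (g-joins i false)) (g-joins i true)
    (λ a → P-vertex-not-x i a i false) (λ a → P-vertex-not-x i a i true) (x-distinct-sides i)

  Q : Fin p → Path G H
  Q i = Ext.extend i

  Q-FPath : ∀ i → IsFPath G F M (Q i)
  Q-FPath i = end-deg , interior-deg , g-in-F i false , subst (T ∘ F) (sym (Ext.extend-last-edge i)) (g-in-F i true)
    where
    end-deg : ∀ s → deg G H (endpoint (Q i) s) ≡ 3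
    end-deg false = deg-H-x i false
    end-deg true  = subst (λ v → deg G H v ≡ 3) (sym (Ext.ext-vs-last i)) (deg-H-x i true)
    interior-deg : ∀ b → Interior (Q i) b → deg G H (vs (Q i) b) ≡ 2
    interior-deg b int = let (a , v≡) = Ext.extend-interior i b int in
      subst (λ v → deg G H v ≡ 2) (sym v≡) (deg-H-matched (deg-M-on-P i a))

  Q-simple : ∀ i → IsSimpleFPath G F M (Q i)
  Q-simple i c e∈F odd = [ inj₁ , [ inj₂ , inner ]′ ]′ (Ext.extend-edges i c)
    where
    inner : (Σ (Fin (suc (k (P i)))) λ c′ → es (Q i) c ≡ es (P i) c′) → _
    inner (c′ , e≡) = ⊥-elim (¬odd×even odd (subst (λ e → OnEvenCycle G F (proj₁ (ends e))) (sym e≡)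
      (P-F-edge-even i c′ (subst (T ∘ F) e≡ e∈F) (from (incident⇔ends G) (inj₁ refl)))))

  Q-covers : ∀ v → deg G H v ≡ 3 → ∃[ i ] ∃[ s ] (endpoint (Q i) s ≡ v)
  Q-covers v deg≡3 = let (i , s , v≡x) = deg-H-3⇒x deg≡3 in i , s , trans (Q-end i s) (sym v≡x)
    where
    Q-end : ∀ i s → endpoint (Q i) s ≡ x i s
    Q-end i false = refl
    Q-end i true  = Ext.ext-vs-last i

  -- The interior vertices have degree 2 in H_odd, so two K_odd edges sharing one run together up to
  -- a common end, where P-separated identifies them; d is the distance left to that end.
  interiors-meet : ∀ d i j {a b} → toℕ a + d ≡ suc (k (P i)) → Interior (P i) a → Interior (P j) b →
    vs (P i) a ≡ vs (P j) b → i ≡ j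
  interiors-meet zero i j {a} a≡last (_ , a≢last) _ _ =
    ⊥-elim (a≢last (toℕ-injective (trans (trans (sym (+-identityʳ (toℕ a))) a≡last) (sym (toℕ-fromℕ _)))))
  interiors-meet (suc d) i j {a} {b} a+d≡ (_ , a≢last) int-b va≡vb =
    let (a′ , a′≡a) = below-last a a≢last
        step-joins = subst (λ v → Joins G (es (P i) a′) v (vs (P i) (suc a′)))
                       (trans (cong (vs (P i)) a′≡a) va≡vb) (joins (P i) a′)
        (c , vc≡) = interior-neighbour G (P j) int-b (deg-Hodd-even (interior-even j int-b)) (inS (P i) a′) step-joins
        fuel = trans (sym (+-suc (toℕ a′) d))
                 (trans (cong (_+ suc d) (sym (toℕ-inject₁ a′))) (trans (cong (λ z → toℕ z + suc d) a′≡a) a+d≡))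
    in next (P-vertex-kind i (suc a′)) (P-vertex-kind j c) (sym vc≡) fuel
    where
    next : ∀ {a″ c} → AtEnd i a″ ⊎ Interior (P i) a″ → AtEnd j c ⊎ Interior (P j) c →
      vs (P i) a″ ≡ vs (P j) c → toℕ a″ + d ≡ suc (k (P i)) → i ≡ j
    next (inj₁ (s , ≡y)) (inj₁ (t , ≡y′)) eq _ =
      proj₁ (P-separated i j s t (subst (Walk G F (y i s)) (trans (sym ≡y) (trans eq ≡y′)) nil))
    next (inj₁ (s , ≡y)) (inj₂ int) eq _ =
      ⊥-elim (¬odd×even (y-odd i s) (subst (OnEvenCycle G F) (trans (sym eq) ≡y) (interior-even j int)))
    next (inj₂ int) (inj₁ (t , ≡y′)) eq _ =
      ⊥-elim (¬odd×even (y-odd j t) (subst (OnEvenCycle G F) (trans eq ≡y′) (interior-even i int)))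
    next (inj₂ int) (inj₂ int′) eq fuel = interiors-meet d i j fuel int int′ eq

  OnOddCycleOf InteriorOf : Fin p → Fin n → Set
  OnOddCycleOf i w = Σ Bool λ s → OnCycleOf i s w
  InteriorOf i w   = Σ (Fin (suc (suc (k (P i))))) λ a → Interior (P i) a × w ≡ vs (P i) a

  Q-vertex-kind : ∀ i b → OnOddCycleOf i (vs (Q i) b) ⊎ InteriorOf i (vs (Q i) b)
  Q-vertex-kind i b = by-position (Ext.position i b)
    where
    by-position : ∀ {b} → Ext.Position i b → OnOddCycleOf i (vs (Q i) b) ⊎ InteriorOf i (vs (Q i) b)
    by-position Ext.first     = inj₁ (false , nil)
    by-position Ext.last      = inj₁ (true , subst (OnCycleOf i true) (sym (Ext.ext-vs-last i)) nil)
    by-position (Ext.inner a) =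
      [ (λ (s , v≡y) → inj₁ (s , subst (OnCycleOf i s) (sym (trans (Ext.ext-vs-inner i a) v≡y)) (x-y-walk i s))) ,
        (λ int → inj₂ (a , int , Ext.ext-vs-inner i a)) ]′ (P-vertex-kind i a)

  Q-disjoint : ∀ i j a b → vs (Q i) a ≡ vs (Q j) b → i ≡ j
  Q-disjoint i j a b eq = by-kind (Q-vertex-kind i a) (Q-vertex-kind j b)
    where
    by-kind : OnOddCycleOf i (vs (Q i) a) ⊎ InteriorOf i (vs (Q i) a) →
              OnOddCycleOf j (vs (Q j) b) ⊎ InteriorOf j (vs (Q j) b) → i ≡ j
    by-kind (inj₁ (s , on-i)) (inj₁ (t , on-j)) =
      proj₁ (same-cycle {i} {s} {j} {t} on-i (subst (OnCycleOf j t) (sym eq) on-j))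
    by-kind (inj₁ (s , on-i)) (inj₂ (b′ , int , v≡)) =
      ⊥-elim (¬odd×even (on-cycle-odd i s on-i) (subst (OnEvenCycle G F) (sym (trans eq v≡)) (interior-even j int)))
    by-kind (inj₂ (a′ , int , v≡)) (inj₁ (t , on-j)) =
      ⊥-elim (¬odd×even (on-cycle-odd j t on-j) (subst (OnEvenCycle G F) (sym (trans (sym eq) v≡)) (interior-even i int)))
    by-kind (inj₂ (a′ , int , v≡)) (inj₂ (b′ , int′ , v≡′)) =
      interiors-meet (suc (k (P i)) ∸ toℕ a′) i j (m+[n∸m]≡n (≤-pred (toℕ<n a′))) int int′
        (trans (sym v≡) (trans eq v≡′))

  simple-F-matching : HasSimpleFMatching G F M
  simple-F-matching = p , Q , (λ i → Q-FPath i , Q-simple i) , Q-disjoint , Q-covers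

proposition7 : (G : Graph) → Snark G → (F : EdgeSet G) → IsTwoFactor G F →
    Σ (EdgeSet G) (λ Meven → IsPerfectMatchingOfFeven G F Meven × KoddHasPerfectMatching G F Meven) →
    Σ (EdgeSet G) (λ M → IsMaximumMatchingIn G F M × HasSimpleFMatching G F M)
proposition7 G (cubic , _ , _) F isTwoFactor (Meven , Meven-perfect , p , P , P-Kodd , P-covers , P-separated) =
  M , (M-matching , M-maximum) , simple-F-matching
  where
  open Construction G F isTwoFactor Meven Meven-perfect p P P-Kodd P-covers P-separated
  open SimpleFMatching G cubic F isTwoFactor Meven Meven-perfect p P P-Kodd P-covers P-separated
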